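{- Let $\Gamma_x=\Gamma,x:\tau_1\to\dots\to\tau_n\to\sigma$ and let $xM_1\dots M_n$ be a linear $\lambda$-term with $\Gamma_x\vdash xM_1\dots M_n:\rho$. Then: (1) $\Gamma_x\vdash xM_1\dots M_n:\sigma$, and $\Gamma|_{M_i}\vdash M_i:\tau_i$ for $1\le i\le n$; (2) $y:\sigma\vdash y:\rho$.
   Context: $\Gamma|_{M}$ denotes the set of premises of $\Gamma$ whose subjects are free variables of $M$. Types: $\sigma ::= \varphi \mid \sigma\to\sigma \mid \sigma\wedge\sigma \mid \sigma\vee\sigma$ ($\varphi$ atomic). A $\lambda$-term is linear if each variable occurs exactly once. Typing rules (environments finite sets of $x:\sigma$ with distinct variables, $\Gamma_1,\Gamma_2$ disjoint): (Ax) $x:\sigma\vdash x:\sigma$; ($\to$I) from $\Gamma,x:\sigma\vdash M:\tau$ infer $\Gamma\vdash\lambda x.M:\sigma\to\tau$; ($\to$E) from $\Gamma_1\vdash M:\sigma\to\tau$, $\Gamma_2\vdash N:\sigma$ infer $\Gamma_1,\Gamma_2\vdash MN:\tau$; ($\wedge$I) from $\Gamma\vdash M:\sigma$, $\Gamma\vdash M:\tau$ infer $\Gamma\vdash M:\sigma\wedge\tau$; ($\wedge$E) from $\Gamma\vdash M:\sigma\wedge\tau$ infer $\Gamma\vdash M:\sigma$ and $\Gamma\vdash M:\tau$; ($\vee$I) from $\Gamma\vdash M:\sigma$ infer $\Gamma\vdash M:\sigma\vee\tau$ and $\Gamma\vdash M:\tau\vee\sigma$; ($\vee$E) from $\Gamma_1,x:\sigma\wedge\theta\vdash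 M:\rho$, $\Gamma_1,x:\tau\wedge\theta\vdash M:\rho$, $\Gamma_2\vdash N:(\sigma\vee\tau)\wedge\theta$ infer $\Gamma_1,\Gamma_2\vdash M[N/x]:\rho$. -}

module Defs where

open import Data.Nat using (ℕ; zero; suc; _+_; _≟_)
open import Data.Bool using (if_then_else_)
open import Data.Fin using (Fin)
open import Data.Vec using (Vec; []; _∷_; lookup)
open import Data.List using (List; []; _∷_; [_]; _++_; filter; map)
open import Data.Product using (_×_; _,_; proj₁)
open import Relation.Nullary.Decidable using (⌊_⌋; ¬?)
open import Relation.Binary.PropositionalEquality using (_≡_)
open import Data.List.Membership.DecPropositional _≟_ using (_∈?_)
open import Data.List.Relation.Unary.Unique.Propositional using (Unique)
open import Data.List.Relation.Binary.Disjoint.Propositional using (Disjoint)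
open import Data.List.Relation.Binary.Permutation.Propositional using (_↭_)

Var : Set
Var = ℕ

data Ty : Set where
  atom : ℕ → Ty
  _⇒_  : Ty → Ty → Ty
  _∧_  : Ty → Ty → Ty
  _∨_  : Ty → Ty → Ty
infixr 5 _⇒_
infixr 6 _∨_
infixr 7 _∧_

data Term : Set where
  var : Var → Term
  lam : Var → Term → Term
  app : Term → Term → Term

-- free variables (as a list, possibly with repetitions)
fv : Term → List Var
fv (var y)   = [ y ]
fv (lam y M) = filter (λ z → ¬? (z ≟ y)) (fv M)
fv (app M N) = fv M ++ fv N

bv : Term → List Var
bv (var y)   = []
bv (lam y M) = y ∷ bv M
bv (app M N) = bv M ++ bv N

countFree : Var → Term → ℕ
countFree x (var y)   = if ⌊ x ≟ y ⌋ then 1 else 0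
countFree x (lam y M) = if ⌊ x ≟ y ⌋ then 0 else countFree x M
countFree x (app M N) = countFree x M + countFree x N

-- Linear terms: each variable occurs exactly once
-- (every abstracted variable occurs free exactly once in the body,
--  and the two sides of an application share no free variable).
data Linear : Term → Set where
  lin-var : ∀ {y} → Linear (var y)
  lin-lam : ∀ {y M} → Linear M → countFree y M ≡ 1 → Linear (lam y M)
  lin-app : ∀ {M N} → Linear M → Linear N → Disjoint (fv M) (fv N) → Linear (app M N)

-- Substitution M[N/x]; it is capture-avoiding whenever no bound variable
-- of M is free in N, which is imposed as a side condition where it is used.
_[_/_] : Term → Term → Var → Term
var y   [ N / x ] = if ⌊ y ≟ x ⌋ then N else var y
lam y M [ N / x ] = if ⌊ y ≟ x ⌋ then lam y M else lam y (M [ N / x ])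
app M P [ N / x ] = app (M [ N / x ]) (P [ N / x ])

-- Environments: finite sets of premises x:σ, represented as lists;
-- lists are identified up to permutation (_↭_) and must have distinct subjects.
Env : Set
Env = List (Var × Ty)

dom : Env → List Var
dom = map proj₁

_∣_ : Env → Term → Env
Γ ∣ M = filter (λ p → proj₁ p ∈? fv M) Γ

infix 4 _⊢_∶_
data _⊢_∶_ : Env → Term → Ty → Set where
  Ax  : ∀ {x σ} → [ (x , σ) ] ⊢ var x ∶ σ
  →I  : ∀ {Γ Δ x σ τ M} → Δ ↭ ((x , σ) ∷ Γ) → Δ ⊢ M ∶ τ → Γ ⊢ lam x M ∶ σ ⇒ τ
  →E  : ∀ {Γ Γ₁ Γ₂ M N σ τ} → Γ ↭ (Γ₁ ++ Γ₂) → Unique (dom Γ) →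
        Γ₁ ⊢ M ∶ σ ⇒ τ → Γ₂ ⊢ N ∶ σ → Γ ⊢ app M N ∶ τ
  ∧I  : ∀ {Γ M σ τ} → Γ ⊢ M ∶ σ → Γ ⊢ M ∶ τ → Γ ⊢ M ∶ σ ∧ τ
  ∧E₁ : ∀ {Γ M σ τ} → Γ ⊢ M ∶ σ ∧ τ → Γ ⊢ M ∶ σ
  ∧E₂ : ∀ {Γ M σ τ} → Γ ⊢ M ∶ σ ∧ τ → Γ ⊢ M ∶ τ
  ∨I₁ : ∀ {Γ M σ τ} → Γ ⊢ M ∶ σ → Γ ⊢ M ∶ σ ∨ τ
  ∨I₂ : ∀ {Γ M σ τ} → Γ ⊢ M ∶ σ → Γ ⊢ M ∶ τ ∨ σ
  ∨E  : ∀ {Γ Γ₁ Γ₂ Δ₁ Δ₂ x M N σ τ θ ρ} →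
        Γ ↭ (Γ₁ ++ Γ₂) → Unique (dom Γ) →
        Disjoint (bv M) (fv N) →
        Δ₁ ↭ ((x , σ ∧ θ) ∷ Γ₁) → Δ₁ ⊢ M ∶ ρ →
        Δ₂ ↭ ((x , τ ∧ θ) ∷ Γ₁) → Δ₂ ⊢ M ∶ ρ →
        Γ₂ ⊢ N ∶ (σ ∨ τ) ∧ θ →
        Γ ⊢ M [ N / x ] ∶ ρ

apps : ∀ {n} → Term → Vec Term n → Term
apps M []       = M
apps M (N ∷ Ns) = apps (app M N) Ns

arrows : ∀ {n} → Vec Ty n → Ty → Ty
arrows []       σ = σ
arrows (τ ∷ τs) σ = τ ⇒ arrows τs σ

module Submission where

-- Write x M₁ … Mₙ as a spine and prove, by induction on the derivation, a stronger inversion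
-- (SpineInversion): if a spine z Ms whose head is fresh in its arguments has type ρ, and z has a
-- type A from which τ₁ ⇒ … ⇒ τₙ ⇒ σ is derivable, then y : σ ⊢ y : ρ and every argument has its
-- τᵢ from its own free variables. The ∧/∨ rules act on y : σ ⊢ y : ρ directly and →E consumes one
-- argument. In ∨E, M [ N / x ] is a spine either because M is one with a head other than x (both
-- branches type the arguments, and ∨E recombines them), or because M = x Ms′ and N = z Ns. Then
-- either Ms′ is empty and the rule instance is a cut of σ against the two branches, or x has an
-- arrow type derived from (α ∨ β) ∧ θ. Arrows are prime for this derivability, as a semantics that
-- reads arrows as propositional letters shows, so a single branch types x Ms′. Linearity is needed
-- only to make x fresh in the Mᵢ; the rules are relevant, so environments match free variables.

open import Defs
open import Data.Nat using (ℕ; _≟_)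
open import Data.Unit using (⊤; tt)
open import Data.Empty using (⊥-elim)
open import Data.Fin using (Fin; zero; suc)
open import Data.Vec using (Vec; lookup; toList; []; _∷_)
open import Data.List using (List; []; _∷_; [_]; _++_; map; reverse; reverseAcc)
open import Data.List.Properties
  using (map-++; map-id-local; reverse-involutive; filter-all; filter-accept; filter-reject)
open import Data.Product using (_×_; _,_; proj₁; proj₂; ∃; ∃₂; map₁; map₂)
open import Data.Sum using (_⊎_; inj₁; inj₂)
open import Function using (_∘_)
open import Function.Bundles using (mk⇔)
open import Relation.Nullary using (yes; no)
open import Relation.Nullary.Decidable using (¬?)
open import Relation.Binary.PropositionalEquality
  using (_≡_; _≢_; refl; sym; trans; cong; cong₂; subst; subst₂; setoid)
open import Data.List.Membership.Propositional using (_∈_; _∉_)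
open import Data.List.Membership.DecPropositional _≟_ using (_∈?_)
open import Data.List.Membership.Propositional.Properties
  using (∈-++⁺ˡ; ∈-++⁺ʳ; ∈-++⁻; ∈-map⁺; ∈-map⁻; ∈-filter⁺; ∈-filter⁻)
open import Data.List.Relation.Unary.Any using (here; there)
open import Data.List.Relation.Unary.All as All using (All; []; _∷_)
import Data.List.Relation.Unary.All.Properties as All
open import Data.List.Relation.Unary.AllPairs using ([]; _∷_)
import Data.List.Relation.Unary.AllPairs.Properties as AllPairs
open import Data.List.Relation.Unary.Unique.Propositional using (Unique)
import Data.List.Relation.Unary.Unique.Propositional.Properties as Unique
open import Data.List.Relation.Binary.Subset.Propositional using (_⊆_)
import Data.List.Relation.Binary.Subset.Propositional.Properties as Subset
open import Data.List.Relation.Binary.Disjoint.Propositional using (Disjoint)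
open import Data.List.Relation.Binary.Pointwise as Pointwise using (Pointwise; []; _∷_)
open import Data.List.Relation.Binary.Permutation.Propositional
  using (_↭_; ↭-refl; ↭-sym; ↭-trans; ↭-reflexive; prep; ↭⇒↭ₛ)
open import Data.List.Relation.Binary.Permutation.Propositional.Properties
  using (∈-resp-↭; ↭-singleton-inv; filter-↭) renaming (map⁺ to ↭-map⁺)
import Data.List.Relation.Binary.Permutation.Setoid.Properties as Permutationₛ
open import Data.List.Membership.Propositional.Properties.WithK using (unique∧set⇒bag)
open import Data.List.Relation.Binary.BagAndSetEquality using (∼bag⇒↭)

-- Environments

Distinct : Env → Set
Distinct Γ = Unique (dom Γ)

Distinct-resp-↭ : ∀ {Γ Δ} → Γ ↭ Δ → Distinct Γ → Distinct Δ
Distinct-resp-↭ Γ↭Δ = Permutationₛ.Unique-resp-↭ (setoid Var) (↭⇒↭ₛ (↭-map⁺ proj₁ Γ↭Δ))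

∈-dom⁺ : ∀ {Γ : Env} {y A} → (y , A) ∈ Γ → y ∈ dom Γ
∈-dom⁺ = ∈-map⁺ proj₁

∈-dom⁻ : ∀ {Γ : Env} {y} → y ∈ dom Γ → ∃ λ A → (y , A) ∈ Γ
∈-dom⁻ y∈ with ∈-map⁻ proj₁ y∈
... | (_ , A) , p∈ , refl = A , p∈

dom-mono : ∀ {Γ Δ : Env} → Γ ⊆ Δ → dom Γ ⊆ dom Δ
dom-mono = Subset.map⁺ proj₁

Distinct-tail : ∀ {p} {Γ : Env} → Distinct (p ∷ Γ) → Distinct Γ
Distinct-tail (_ ∷ dΓ) = dΓ

head∉dom : ∀ {y A} {Γ : Env} → Distinct ((y , A) ∷ Γ) → y ∉ dom Γ
head∉dom = Unique.Unique[x∷xs]⇒x∉xs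

∈-functional : ∀ {Γ y A B} → Distinct Γ → (y , A) ∈ Γ → (y , B) ∈ Γ → A ≡ B
∈-functional _            (here refl) (here refl) = refl
∈-functional (y∉Γ ∷ _)    (here refl) (there p∈) = ⊥-elim (All.lookup y∉Γ (∈-dom⁺ p∈) refl)
∈-functional (y∉Γ ∷ _)    (there p∈) (here refl) = ⊥-elim (All.lookup y∉Γ (∈-dom⁺ p∈) refl)
∈-functional (_ ∷ dΓ)     (there p∈) (there q∈) = ∈-functional dΓ p∈ q∈

∈-⊆-dom : ∀ {Γ Δ y A} → Distinct Δ → Γ ⊆ Δ → (y , A) ∈ Δ → y ∈ dom Γ → (y , A) ∈ Γ
∈-⊆-dom dΔ Γ⊆Δ p∈Δ y∈Γ with ∈-dom⁻ y∈Γ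
... | _ , q∈Γ with ∈-functional dΔ p∈Δ (Γ⊆Δ q∈Γ)
... | refl = q∈Γ

↭-++-⊆ˡ : ∀ {Γ Γ₁ Γ₂ : Env} → Γ ↭ Γ₁ ++ Γ₂ → Γ₁ ⊆ Γ
↭-++-⊆ˡ Γ↭ = ∈-resp-↭ (↭-sym Γ↭) ∘ ∈-++⁺ˡ

↭-++-⊆ʳ : ∀ {Γ Γ₁ Γ₂ : Env} → Γ ↭ Γ₁ ++ Γ₂ → Γ₂ ⊆ Γ
↭-++-⊆ʳ {Γ₁ = Γ₁} Γ↭ = ∈-resp-↭ (↭-sym Γ↭) ∘ ∈-++⁺ʳ Γ₁

-- Turns every permutation obligation of the typing rules into set reasoning.
distinct-⊆⊇⇒↭ : ∀ {Γ Δ} → Distinct Γ → Distinct Δ → Γ ⊆ Δ → Δ ⊆ Γ → Γ ↭ Δ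
distinct-⊆⊇⇒↭ dΓ dΔ Γ⊆Δ Δ⊆Γ =
  ∼bag⇒↭ (unique∧set⇒bag (Unique.map⁻ dΓ) (Unique.map⁻ dΔ) (mk⇔ Γ⊆Δ Δ⊆Γ))

Unique-++⁻ : ∀ (xs : List Var) {ys} → Unique (xs ++ ys) → Unique xs × Unique ys × Disjoint xs ys
Unique-++⁻ []       u           = [] , u , λ { (() , _) }
Unique-++⁻ (x ∷ xs) (x∉ ∷ u) with Unique-++⁻ xs u | All.++⁻ xs x∉
... | uxs , uys , xs#ys | x∉xs , x∉ys = x∉xs ∷ uxs , uys , x∷xs#ys
  where
  x∷xs#ys : Disjoint (x ∷ xs) _
  x∷xs#ys (here refl , x∈ys) = All.lookup x∉ys x∈ys refl
  x∷xs#ys (there v∈xs , v∈ys) = xs#ys (v∈xs , v∈ys)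

Distinct-++⁻ : ∀ Γ₁ {Γ₂} → Distinct (Γ₁ ++ Γ₂) →
               Distinct Γ₁ × Distinct Γ₂ × Disjoint (dom Γ₁) (dom Γ₂)
Distinct-++⁻ Γ₁ {Γ₂} d = Unique-++⁻ (dom Γ₁) (subst Unique (map-++ proj₁ Γ₁ Γ₂) d)

Distinct-++⁺ : ∀ {Γ₁ Γ₂} → Distinct Γ₁ → Distinct Γ₂ → Disjoint (dom Γ₁) (dom Γ₂) →
               Distinct (Γ₁ ++ Γ₂)
Distinct-++⁺ {Γ₁} {Γ₂} d₁ d₂ d₁#d₂ = subst Unique (sym (map-++ proj₁ Γ₁ Γ₂)) (Unique.++⁺ d₁ d₂ d₁#d₂)

∈-∣⁺ : ∀ {Γ : Env} M {p} → p ∈ Γ → proj₁ p ∈ fv M → p ∈ Γ ∣ M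
∈-∣⁺ M = ∈-filter⁺ (λ p → proj₁ p ∈? fv M)

∈-∣⁻ : ∀ (Γ : Env) M {p} → p ∈ Γ ∣ M → p ∈ Γ × proj₁ p ∈ fv M
∈-∣⁻ Γ M = ∈-filter⁻ (λ p → proj₁ p ∈? fv M) {xs = Γ}

∣-⊆ : ∀ (Γ : Env) M → Γ ∣ M ⊆ Γ
∣-⊆ Γ M = proj₁ ∘ ∈-∣⁻ Γ M

dom-∣⊆fv : ∀ (Γ : Env) M → dom (Γ ∣ M) ⊆ fv M
dom-∣⊆fv Γ M y∈ with ∈-dom⁻ y∈
... | _ , p∈ = proj₂ (∈-∣⁻ Γ M p∈)

∣-∷-fresh : ∀ {x A Γ} M → x ∉ fv M → ((x , A) ∷ Γ) ∣ M ≡ Γ ∣ M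
∣-∷-fresh M = filter-reject (λ p → proj₁ p ∈? fv M)

Distinct-∣ : ∀ {Γ} M → Distinct Γ → Distinct (Γ ∣ M)
Distinct-∣ M d = AllPairs.map⁺ (AllPairs.filter⁺ (λ p → proj₁ p ∈? fv M) (AllPairs.map⁻ d))

∣-all : ∀ {Γ} M → dom Γ ⊆ fv M → Γ ∣ M ≡ Γ
∣-all {Γ} M dom⊆fv = filter-all (λ p → proj₁ p ∈? fv M) (All.tabulate (dom⊆fv ∘ ∈-dom⁺))

∣-↭ : ∀ {Γ Δ} M → Distinct Γ → Distinct Δ → Γ ⊆ Δ → dom Γ ⊆ fv M → fv M ⊆ dom Γ → Δ ∣ M ↭ Γ
∣-↭ {Γ} {Δ} M dΓ dΔ Γ⊆Δ dom⊆fv fv⊆dom = distinct-⊆⊇⇒↭ (Distinct-∣ M dΔ) dΓ restricted⊆Γ Γ⊆restricted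
  where
  restricted⊆Γ : Δ ∣ M ⊆ Γ
  restricted⊆Γ p∈ with ∈-∣⁻ Δ M p∈
  ... | p∈Δ , y∈M = ∈-⊆-dom dΔ Γ⊆Δ p∈Δ (fv⊆dom y∈M)
  Γ⊆restricted : Γ ⊆ Δ ∣ M
  Γ⊆restricted p∈Γ = ∈-∣⁺ M (Γ⊆Δ p∈Γ) (dom⊆fv (∈-dom⁺ p∈Γ))

-- Substitution and spines

∈-fv-lam⁺ : ∀ {y w} M → y ∈ fv M → y ≢ w → y ∈ fv (lam w M)
∈-fv-lam⁺ {w = w} M = ∈-filter⁺ (λ z → ¬? (z ≟ w))

∈-fv-lam⁻ : ∀ {y w} M → y ∈ fv (lam w M) → y ∈ fv M × y ≢ w
∈-fv-lam⁻ {w = w} M = ∈-filter⁻ (λ z → ¬? (z ≟ w))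

var-[/]-self : ∀ x N → var x [ N / x ] ≡ N
var-[/]-self x N with x ≟ x
... | yes _  = refl
... | no x≢x = ⊥-elim (x≢x refl)

[/]-fresh : ∀ M {N x} → x ∉ fv M → M [ N / x ] ≡ M
[/]-fresh (var w) {x = x} x∉ with w ≟ x
... | yes refl = ⊥-elim (x∉ (here refl))
... | no _     = refl
[/]-fresh (lam w M) {x = x} x∉ with w ≟ x
... | yes _   = refl
... | no w≢x  = cong (lam w) ([/]-fresh M (λ x∈ → x∉ (∈-fv-lam⁺ M x∈ (w≢x ∘ sym))))
[/]-fresh (app M P) x∉ = cong₂ app ([/]-fresh M (x∉ ∘ ∈-++⁺ˡ)) ([/]-fresh P (x∉ ∘ ∈-++⁺ʳ _))

∈-fv-[/]⁺ˡ : ∀ M {N x y} → y ∈ fv M → y ≢ x → y ∈ fv (M [ N / x ])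
∈-fv-[/]⁺ˡ (var w) {x = x} (here refl) y≢x with w ≟ x
... | yes w≡x = ⊥-elim (y≢x w≡x)
... | no _    = here refl
∈-fv-[/]⁺ˡ (lam w M) {N} {x} y∈ y≢x with w ≟ x | ∈-fv-lam⁻ M y∈
... | yes _ | _          = y∈
... | no _  | y∈M , y≢w  = ∈-fv-lam⁺ (M [ N / x ]) (∈-fv-[/]⁺ˡ M y∈M y≢x) y≢w
∈-fv-[/]⁺ˡ (app M P) y∈ y≢x with ∈-++⁻ (fv M) y∈
... | inj₁ y∈M = ∈-++⁺ˡ (∈-fv-[/]⁺ˡ M y∈M y≢x)
... | inj₂ y∈P = ∈-++⁺ʳ _ (∈-fv-[/]⁺ˡ P y∈P y≢x)

-- The side condition excludes capture of the free variables of N.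
∈-fv-[/]⁺ʳ : ∀ M {N x y} → x ∈ fv M → Disjoint (bv M) (fv N) → y ∈ fv N → y ∈ fv (M [ N / x ])
∈-fv-[/]⁺ʳ (var w) {x = x} (here refl) _ y∈N with w ≟ x
... | yes _  = y∈N
... | no w≢w = ⊥-elim (w≢w refl)
∈-fv-[/]⁺ʳ (lam w M) {N} {x} x∈ bv#fv y∈N with w ≟ x | ∈-fv-lam⁻ M x∈
... | yes w≡x | _ , x≢w = ⊥-elim (x≢w (sym w≡x))
... | no _    | x∈M , _ =
  ∈-fv-lam⁺ (M [ N / x ]) (∈-fv-[/]⁺ʳ M x∈M (λ (u , v) → bv#fv (there u , v)) y∈N)
                          (λ { refl → bv#fv (here refl , y∈N) })
∈-fv-[/]⁺ʳ (app M P) x∈ bv#fv y∈N with ∈-++⁻ (fv M) x∈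
... | inj₁ x∈M = ∈-++⁺ˡ (∈-fv-[/]⁺ʳ M x∈M (λ (u , v) → bv#fv (∈-++⁺ˡ u , v)) y∈N)
... | inj₂ x∈P = ∈-++⁺ʳ _ (∈-fv-[/]⁺ʳ P x∈P (λ (u , v) → bv#fv (∈-++⁺ʳ (bv M) u , v)) y∈N)

∈-fv-[/]⁻ : ∀ M {N x y} → y ∈ fv (M [ N / x ]) → (y ∈ fv M × y ≢ x) ⊎ y ∈ fv N
∈-fv-[/]⁻ (var w) {x = x} y∈ with w ≟ x
∈-fv-[/]⁻ (var w) y∈          | yes _ = inj₂ y∈
∈-fv-[/]⁻ (var w) (here refl) | no w≢x = inj₁ (here refl , w≢x)
∈-fv-[/]⁻ (lam w M) {N} {x} y∈ with w ≟ x
... | yes refl = inj₁ (y∈ , proj₂ (∈-fv-lam⁻ M y∈))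
... | no _ with ∈-fv-lam⁻ (M [ N / x ]) y∈
...   | y∈M[N/x] , y≢w with ∈-fv-[/]⁻ M y∈M[N/x]
...     | inj₁ (y∈M , y≢x) = inj₁ (∈-fv-lam⁺ M y∈M y≢w , y≢x)
...     | inj₂ y∈N         = inj₂ y∈N
∈-fv-[/]⁻ (app M P) {N} {x} y∈ with ∈-++⁻ (fv (M [ N / x ])) y∈
... | inj₁ y∈M′ with ∈-fv-[/]⁻ M y∈M′
...   | inj₁ (y∈M , y≢x) = inj₁ (∈-++⁺ˡ y∈M , y≢x)
...   | inj₂ y∈N         = inj₂ y∈N
∈-fv-[/]⁻ (app M P) y∈ | inj₂ y∈P′ with ∈-fv-[/]⁻ P y∈P′
...   | inj₁ (y∈P , y≢x) = inj₁ (∈-++⁺ʳ _ y∈P , y≢x)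
...   | inj₂ y∈N         = inj₂ y∈N

-- Arguments are listed from the outermost inwards.
spine : Term → List Term → Term
spine h []       = h
spine h (N ∷ Ns) = app (spine h Ns) N

data NonApp : Term → Set where
  var : ∀ {y} → NonApp (var y)
  lam : ∀ {y M} → NonApp (lam y M)

spine-view : ∀ M → ∃₂ λ h Ms → NonApp h × M ≡ spine h Ms
spine-view (var y)   = var y , [] , var , refl
spine-view (lam y M) = lam y M , [] , lam , refl
spine-view (app M N) with spine-view M
... | h , Ms , h-nonApp , refl = h , N ∷ Ms , h-nonApp , refl

spine-++ : ∀ h Ms Ns → spine (spine h Ms) Ns ≡ spine h (Ns ++ Ms)
spine-++ h Ms []       = refl
spine-++ h Ms (N ∷ Ns) = cong (λ M → app M N) (spine-++ h Ms Ns)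

map[/] : Term → Var → List Term → List Term
map[/] N x = map (λ M → M [ N / x ])

spine-[/] : ∀ h Ms {N x} → spine h Ms [ N / x ] ≡ spine (h [ N / x ]) (map[/] N x Ms)
spine-[/] h []       = refl
spine-[/] h (M ∷ Ms) {N} {x} = cong (λ P → app P (M [ N / x ])) (spine-[/] h Ms)

app-injective : ∀ {M N M′ N′} → app M N ≡ app M′ N′ → M ≡ M′ × N ≡ N′
app-injective refl = refl , refl

spine-cancel : ∀ {h z} Ms Ns → NonApp h → spine h Ms ≡ spine (var z) Ns → h ≡ var z × Ms ≡ Ns
spine-cancel []       []       _   refl = refl , refl
spine-cancel []       (_ ∷ _)  var ()
spine-cancel []       (_ ∷ _)  lam ()
spine-cancel (_ ∷ _)  []       _   ()
spine-cancel (M ∷ Ms) (N ∷ Ns) h-nonApp eq with app-injective eq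
... | spines≡ , refl with spine-cancel Ms Ns h-nonApp spines≡
...   | refl , refl = refl , refl

data Spine[/]View (M N : Term) (x z : Var) (Ms : List Term) : Set where
  head-kept     : ∀ Ms′ → M ≡ spine (var z) Ms′ → z ≢ x → Ms ≡ map[/] N x Ms′ →
                  Spine[/]View M N x z Ms
  head-replaced : ∀ Ms′ Ns → M ≡ spine (var x) Ms′ → N ≡ spine (var z) Ns →
                  Ms ≡ map[/] N x Ms′ ++ Ns → Spine[/]View M N x z Ms

spine[/]-view : ∀ M N x z Ms → M [ N / x ] ≡ spine (var z) Ms → Spine[/]View M N x z Ms
spine[/]-view M N x z Ms eq with spine-view M
... | h , Ms′ , h-nonApp , refl = by-head h-nonApp (trans (sym (spine-[/] h Ms′)) eq)
  where
  by-head : ∀ {h} → NonApp h → spine (h [ N / x ]) (map[/] N x Ms′) ≡ spine (var z) Ms →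
            Spine[/]View (spine h Ms′) N x z Ms
  by-head (var {w}) eq′ with w ≟ x
  ... | no w≢x with spine-cancel _ Ms var eq′
  ...   | refl , Ms≡ = head-kept Ms′ refl w≢x (sym Ms≡)
  by-head (var {w}) eq′ | yes refl with spine-view N
  ...   | h′ , Ns , h′-nonApp , refl
          with spine-cancel _ Ms h′-nonApp (trans (sym (spine-++ h′ Ns (map[/] N x Ms′))) eq′)
  ...     | refl , Ms≡ = head-replaced Ms′ Ns refl refl (sym Ms≡)
  by-head (lam {w}) eq′ with w ≟ x
  ... | yes _ with proj₁ (spine-cancel _ Ms lam eq′)
  ...   | ()
  by-head (lam {w}) eq′ | no _ with proj₁ (spine-cancel _ Ms lam eq′)
  ...   | ()

-- Structural properties of derivations

⊢-distinct : ∀ {Δ M τ} → Δ ⊢ M ∶ τ → Distinct Δ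
⊢-distinct Ax                         = [] ∷ []
⊢-distinct (→I {Γ} {x = x} {σ} Δ↭ D)  = Distinct-tail {x , σ} {Γ} (Distinct-resp-↭ Δ↭ (⊢-distinct D))
⊢-distinct (→E _ dΓ _ _)              = dΓ
⊢-distinct (∧I D _)                   = ⊢-distinct D
⊢-distinct (∧E₁ D)                    = ⊢-distinct D
⊢-distinct (∧E₂ D)                    = ⊢-distinct D
⊢-distinct (∨I₁ D)                    = ⊢-distinct D
⊢-distinct (∨I₂ D)                    = ⊢-distinct D
⊢-distinct (∨E _ dΓ _ _ _ _ _ _)      = dΓ

⊢-resp-↭ : ∀ {Γ Δ M τ} → Γ ↭ Δ → Δ ⊢ M ∶ τ → Γ ⊢ M ∶ τ
⊢-resp-↭ Γ↭ Ax with ↭-singleton-inv Γ↭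
... | refl = Ax
⊢-resp-↭ Γ↭ (→I Δ↭ D)              = →I (↭-trans Δ↭ (prep _ (↭-sym Γ↭))) D
⊢-resp-↭ Γ↭ (→E Δ↭ dΔ D₁ D₂)       = →E (↭-trans Γ↭ Δ↭) (Distinct-resp-↭ (↭-sym Γ↭) dΔ) D₁ D₂
⊢-resp-↭ Γ↭ (∧I D₁ D₂)             = ∧I (⊢-resp-↭ Γ↭ D₁) (⊢-resp-↭ Γ↭ D₂)
⊢-resp-↭ Γ↭ (∧E₁ D)                = ∧E₁ (⊢-resp-↭ Γ↭ D)
⊢-resp-↭ Γ↭ (∧E₂ D)                = ∧E₂ (⊢-resp-↭ Γ↭ D)
⊢-resp-↭ Γ↭ (∨I₁ D)                = ∨I₁ (⊢-resp-↭ Γ↭ D)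
⊢-resp-↭ Γ↭ (∨I₂ D)                = ∨I₂ (⊢-resp-↭ Γ↭ D)
⊢-resp-↭ Γ↭ (∨E Δ↭ dΔ bv#fv Δ₁↭ D₁ Δ₂↭ D₂ D₃) =
  ∨E (↭-trans Γ↭ Δ↭) (Distinct-resp-↭ (↭-sym Γ↭) dΔ) bv#fv Δ₁↭ D₁ Δ₂↭ D₂ D₃

dom-resp-↭ : ∀ {Γ Δ} → Γ ↭ Δ → dom Γ ⊆ dom Δ
dom-resp-↭ Γ↭Δ = dom-mono (∈-resp-↭ Γ↭Δ)

dom≐fv : ∀ {Δ M τ} → Δ ⊢ M ∶ τ → dom Δ ⊆ fv M × fv M ⊆ dom Δ
dom≐fv Ax = (λ y∈ → y∈) , (λ y∈ → y∈)
dom≐fv {Γ} (→I {x = x} {σ} {M = M} Δ↭ D) = dom⊆ , fv⊆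
  where
  x∉Γ : x ∉ dom Γ
  x∉Γ = head∉dom {A = σ} (Distinct-resp-↭ Δ↭ (⊢-distinct D))
  dom⊆ : dom Γ ⊆ fv (lam x M)
  dom⊆ y∈ = ∈-fv-lam⁺ M (proj₁ (dom≐fv D) (dom-resp-↭ (↭-sym Δ↭) (there y∈))) λ { refl → x∉Γ y∈ }
  fv⊆ : fv (lam x M) ⊆ dom Γ
  fv⊆ y∈ with ∈-fv-lam⁻ M y∈
  ... | y∈M , y≢x with dom-resp-↭ Δ↭ (proj₂ (dom≐fv D) y∈M)
  ...   | here y≡x = ⊥-elim (y≢x y≡x)
  ...   | there y∈Γ = y∈Γ
dom≐fv {Γ} (→E {Γ₁ = Γ₁} {Γ₂} {M} {N} Γ↭ _ D₁ D₂) = dom⊆ , fv⊆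
  where
  dom⊆ : dom Γ ⊆ fv (app M N)
  dom⊆ y∈ with ∈-++⁻ (dom Γ₁) (subst (_ ∈_) (map-++ proj₁ Γ₁ Γ₂) (dom-resp-↭ Γ↭ y∈))
  ... | inj₁ y∈Γ₁ = ∈-++⁺ˡ (proj₁ (dom≐fv D₁) y∈Γ₁)
  ... | inj₂ y∈Γ₂ = ∈-++⁺ʳ _ (proj₁ (dom≐fv D₂) y∈Γ₂)
  fv⊆ : fv (app M N) ⊆ dom Γ
  fv⊆ y∈ = dom-resp-↭ (↭-sym Γ↭) (subst (_ ∈_) (sym (map-++ proj₁ Γ₁ Γ₂)) (in-++ (∈-++⁻ (fv M) y∈)))
    where
    in-++ : ∀ {y} → y ∈ fv M ⊎ y ∈ fv N → y ∈ dom Γ₁ ++ dom Γ₂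
    in-++ (inj₁ y∈M) = ∈-++⁺ˡ (proj₂ (dom≐fv D₁) y∈M)
    in-++ (inj₂ y∈N) = ∈-++⁺ʳ _ (proj₂ (dom≐fv D₂) y∈N)
dom≐fv (∧I D _) = dom≐fv D
dom≐fv (∧E₁ D)  = dom≐fv D
dom≐fv (∧E₂ D)  = dom≐fv D
dom≐fv (∨I₁ D)  = dom≐fv D
dom≐fv (∨I₂ D)  = dom≐fv D
dom≐fv {Γ} (∨E {Γ₁ = Γ₁} {Γ₂} {x = x} {M} {N} {σ} {θ = θ} Γ↭ _ bv#fv Δ₁↭ D₁ _ _ D₃) = dom⊆ , fv⊆
  where
  x∉Γ₁ : x ∉ dom Γ₁
  x∉Γ₁ = head∉dom {A = σ ∧ θ} (Distinct-resp-↭ Δ₁↭ (⊢-distinct D₁))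
  x∈M : x ∈ fv M
  x∈M = proj₁ (dom≐fv D₁) (dom-resp-↭ (↭-sym Δ₁↭) (here refl))
  dom⊆ : dom Γ ⊆ fv (M [ N / x ])
  dom⊆ y∈ with ∈-++⁻ (dom Γ₁) (subst (_ ∈_) (map-++ proj₁ Γ₁ Γ₂) (dom-resp-↭ Γ↭ y∈))
  ... | inj₁ y∈Γ₁ = ∈-fv-[/]⁺ˡ M (proj₁ (dom≐fv D₁) (dom-resp-↭ (↭-sym Δ₁↭) (there y∈Γ₁)))
                               λ { refl → x∉Γ₁ y∈Γ₁ }
  ... | inj₂ y∈Γ₂ = ∈-fv-[/]⁺ʳ M x∈M bv#fv (proj₁ (dom≐fv D₃) y∈Γ₂)
  fv⊆ : fv (M [ N / x ]) ⊆ dom Γ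
  fv⊆ y∈ = dom-resp-↭ (↭-sym Γ↭) (subst (_ ∈_) (sym (map-++ proj₁ Γ₁ Γ₂)) (in-++ (∈-fv-[/]⁻ M y∈)))
    where
    in-++ : ∀ {y} → (y ∈ fv M × y ≢ x) ⊎ y ∈ fv N → y ∈ dom Γ₁ ++ dom Γ₂
    in-++ (inj₂ y∈N) = ∈-++⁺ʳ _ (proj₂ (dom≐fv D₃) y∈N)
    in-++ (inj₁ (y∈M , y≢x)) with dom-resp-↭ Δ₁↭ (proj₂ (dom≐fv D₁) y∈M)
    ... | here y≡x  = ⊥-elim (y≢x y≡x)
    ... | there y∈Γ₁ = ∈-++⁺ˡ y∈Γ₁

dom⊆fv : ∀ {Δ M τ} → Δ ⊢ M ∶ τ → dom Δ ⊆ fv M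
dom⊆fv = proj₁ ∘ dom≐fv

fv⊆dom : ∀ {Δ M τ} → Δ ⊢ M ∶ τ → fv M ⊆ dom Δ
fv⊆dom = proj₂ ∘ dom≐fv

restrict-⊢ : ∀ {Γ Δ M τ} → Distinct Δ → Γ ⊆ Δ → Γ ⊢ M ∶ τ → Δ ∣ M ⊢ M ∶ τ
restrict-⊢ {M = M} dΔ Γ⊆Δ D = ⊢-resp-↭ (∣-↭ M (⊢-distinct D) dΔ Γ⊆Δ (dom⊆fv D) (fv⊆dom D)) D

-- Derivability between types

infix 4 _≼_ _⊨_

_≼_ : Ty → Ty → Set
σ ≼ ρ = ∀ y → [ (y , σ) ] ⊢ var y ∶ ρ

≼-refl : ∀ {σ} → σ ≼ σ
≼-refl y = Ax

-- Atoms and arrows are both treated as propositional letters.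
Valuation : Set₁
Valuation = Ty → Set

⟦_⟧ : Ty → Valuation → Set
⟦ atom k ⟧ v = v (atom k)
⟦ a ⇒ b ⟧  v = v (a ⇒ b)
⟦ a ∧ b ⟧  v = ⟦ a ⟧ v × ⟦ b ⟧ v
⟦ a ∨ b ⟧  v = ⟦ a ⟧ v ⊎ ⟦ b ⟧ v

_⊨_ : Ty → Ty → Set₁
A ⊨ B = ∀ v → ⟦ A ⟧ v → ⟦ B ⟧ v

var-sound : ∀ {Δ T B} → Δ ⊢ T ∶ B → ∀ {y A} → T ≡ var y → (y , A) ∈ Δ → A ⊨ B
var-sound Ax         refl (here refl) v a = a
var-sound (∧I D₁ D₂) eq y∈ v a = var-sound D₁ eq y∈ v a , var-sound D₂ eq y∈ v a
var-sound (∧E₁ D)    eq y∈ v a = proj₁ (var-sound D eq y∈ v a)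
var-sound (∧E₂ D)    eq y∈ v a = proj₂ (var-sound D eq y∈ v a)
var-sound (∨I₁ D)    eq y∈ v a = inj₁ (var-sound D eq y∈ v a)
var-sound (∨I₂ D)    eq y∈ v a = inj₂ (var-sound D eq y∈ v a)
var-sound (∨E {x = x} {M} {N} _ _ _ Δ₁↭ D₁ _ _ _) {y} eq _
  with spine[/]-view M N x y [] eq
... | head-kept [] refl y≢x _ with dom⊆fv D₁ (dom-resp-↭ (↭-sym Δ₁↭) (here refl))
...   | here x≡y = ⊥-elim (y≢x (sym x≡y))
var-sound (∨E _ _ _ _ _ _ _ _) _ _ | head-kept (_ ∷ _) _ _ ()
var-sound (∨E _ _ _ _ _ _ _ _) _ _ | head-replaced (_ ∷ _) _ _ _ ()
var-sound (∨E _ _ _ _ _ _ _ _) _ _ | head-replaced [] (_ ∷ _) _ _ ()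
var-sound {B = ρ} (∨E {Γ₁ = Γ₁} {Γ₂} {x = x} {M} {N} {α} {β} {θ} Γ↭ dΓ _ Δ₁↭ D₁ Δ₂↭ D₂ D₃) {y} {A} eq y∈Γ
  | head-replaced [] [] refl refl _ = λ v a → by-cases v (var-sound D₃ refl y∈Γ₂ v a)
  where
  y∈Γ₂ : (y , A) ∈ Γ₂
  y∈Γ₂ = ∈-⊆-dom dΓ (↭-++-⊆ʳ {Γ₁ = Γ₁} Γ↭) y∈Γ (fv⊆dom D₃ (here refl))
  by-cases : ∀ v → ⟦ (α ∨ β) ∧ θ ⟧ v → ⟦ ρ ⟧ v
  by-cases v (inj₁ a , t) = var-sound D₁ refl (∈-resp-↭ (↭-sym Δ₁↭) (here refl)) v (a , t)
  by-cases v (inj₂ b , t) = var-sound D₂ refl (∈-resp-↭ (↭-sym Δ₂↭) (here refl)) v (b , t)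

≼-sound : ∀ {σ ρ} → σ ≼ ρ → σ ⊨ ρ
≼-sound σ≼ρ = var-sound (σ≼ρ 0) refl (here refl)

point-complete : ∀ p C → ⟦ C ⟧ (_≡ p) → p ≼ C
point-complete p (atom k) refl y         = Ax
point-complete p (a ⇒ b)  refl y         = Ax
point-complete p (a ∧ b)  (s , t) y      = ∧I (point-complete p a s y) (point-complete p b t y)
point-complete p (a ∨ b)  (inj₁ s) y     = ∨I₁ (point-complete p a s y)
point-complete p (a ∨ b)  (inj₂ t) y     = ∨I₂ (point-complete p b t y)

-- Evaluate at the valuation that holds exactly at a ⇒ b.
⇒≼-prime : ∀ {a b α β θ} → a ⇒ b ≼ (α ∨ β) ∧ θ → a ⇒ b ≼ α ∧ θ ⊎ a ⇒ b ≼ β ∧ θ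
⇒≼-prime {a} {b} {α} {β} {θ} ≼∨ with ≼-sound ≼∨ (_≡ a ⇒ b) refl
... | inj₁ s , t = inj₁ (point-complete (a ⇒ b) (α ∧ θ) (s , t))
... | inj₂ s , t = inj₂ (point-complete (a ⇒ b) (β ∧ θ) (s , t))

⇒≼⇒-injective : ∀ {a b c d} → a ⇒ b ≼ c ⇒ d → a ≡ c × b ≡ d
⇒≼⇒-injective {a} {b} ≼⇒ with ≼-sound ≼⇒ (_≡ a ⇒ b) refl
... | refl = refl , refl

-- Inversion along a spine

head∈fv : ∀ {M z} Ms → M ≡ spine (var z) Ms → z ∈ fv M
head∈fv []       refl = here refl
head∈fv (N ∷ Ms) refl = ∈-++⁺ˡ (head∈fv Ms refl)

arg-bv⊆bv : ∀ {M h P} Ms → M ≡ spine h Ms → P ∈ Ms → bv P ⊆ bv M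
arg-bv⊆bv (N ∷ Ms) refl (here refl) = ∈-++⁺ʳ _
arg-bv⊆bv (N ∷ Ms) refl (there P∈)  = ∈-++⁺ˡ ∘ arg-bv⊆bv Ms refl P∈

spine-app-inv : ∀ {M N z Ms} → app M N ≡ spine (var z) Ms →
                ∃ λ Ms′ → Ms ≡ N ∷ Ms′ × M ≡ spine (var z) Ms′
spine-app-inv {Ms = N ∷ Ms′} refl = Ms′ , refl , refl

-- arrowsʳ [τₙ, …, τ₁] σ = τ₁ ⇒ … ⇒ τₙ ⇒ σ, matching the argument order of spine.
arrowsʳ : List Ty → Ty → Ty
arrowsʳ []       σ = σ
arrowsʳ (τ ∷ τs) σ = arrowsʳ τs (τ ⇒ σ)

arrowsʳ-++ : ∀ τs₁ τs₂ σ → arrowsʳ (τs₁ ++ τs₂) σ ≡ arrowsʳ τs₂ (arrowsʳ τs₁ σ)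
arrowsʳ-++ []        τs₂ σ = refl
arrowsʳ-++ (τ ∷ τs₁) τs₂ σ = arrowsʳ-++ τs₁ τs₂ (τ ⇒ σ)

arrowsʳ-∷ : ∀ τ τs σ → ∃₂ λ a b → arrowsʳ (τ ∷ τs) σ ≡ a ⇒ b
arrowsʳ-∷ τ []        σ = τ , σ , refl
arrowsʳ-∷ τ (τ′ ∷ τs) σ = arrowsʳ-∷ τ′ τs (τ ⇒ σ)

SameLength : List Term → List Ty → Set
SameLength = Pointwise (λ _ _ → ⊤)

SameLength-++⁻ : ∀ Ms₁ {Ms₂ τs} → SameLength (Ms₁ ++ Ms₂) τs →
                 ∃₂ λ τs₁ τs₂ → τs ≡ τs₁ ++ τs₂ × SameLength Ms₁ τs₁ × SameLength Ms₂ τs₂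
SameLength-++⁻ []       len        = [] , _ , refl , [] , len
SameLength-++⁻ (M ∷ Ms) (tt ∷ len) with SameLength-++⁻ Ms len
... | τs₁ , τs₂ , refl , len₁ , len₂ = _ ∷ τs₁ , τs₂ , refl , tt ∷ len₁ , len₂

SameLength-map⁻ : ∀ {f : Term → Term} Ms {τs} → SameLength (map f Ms) τs → SameLength Ms τs
SameLength-map⁻ []       []         = []
SameLength-map⁻ (M ∷ Ms) (tt ∷ len) = tt ∷ SameLength-map⁻ Ms len

Pointwise-map-∈ : ∀ {A B : Set} {R S : A → B → Set} {xs ys} →
                  (∀ {x y} → x ∈ xs → R x y → S x y) → Pointwise R xs ys → Pointwise S xs ys
Pointwise-map-∈ f []         = []
Pointwise-map-∈ f (r ∷ rs)   = f (here refl) r ∷ Pointwise-map-∈ (f ∘ there) rs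

Pointwise-zipWith-∈ : ∀ {A B : Set} {R S T : A → B → Set} (g : A → A) {xs ys} →
                      (∀ {x y} → x ∈ xs → R x y → S x y → T (g x) y) →
                      Pointwise R xs ys → Pointwise S xs ys → Pointwise T (map g xs) ys
Pointwise-zipWith-∈ g f []       []       = []
Pointwise-zipWith-∈ g f (r ∷ rs) (s ∷ ss) = f (here refl) r s ∷ Pointwise-zipWith-∈ g (f ∘ there) rs ss

ArgsTyped : Env → List Term → List Ty → Set
ArgsTyped Δ = Pointwise (λ M τ → Δ ∣ M ⊢ M ∶ τ)

ArgsTyped-⊆ : ∀ {Γ Δ Ms τs} → Distinct Δ → Γ ⊆ Δ → ArgsTyped Γ Ms τs → ArgsTyped Δ Ms τs
ArgsTyped-⊆ {Γ} dΔ Γ⊆Δ = Pointwise.map (λ {M} → restrict-⊢ dΔ (Γ⊆Δ ∘ ∣-⊆ Γ M))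

-- The head z may carry any type A from which its spine type is derivable, not just that type
-- itself: ∨E gives the substituted variable the type α ∧ θ.
SpineInversion : Env → Term → Ty → Set
SpineInversion Δ T ρ =
  ∀ {z Ms A τs σ} → T ≡ spine (var z) Ms → All (λ P → z ∉ fv P) Ms → (z , A) ∈ Δ →
  SameLength Ms τs → arrowsʳ τs σ ≼ A → σ ≼ ρ × ArgsTyped Δ Ms τs

module ∨E-Inversion
  {Γ Γ₁ Γ₂ Δ₁ Δ₂ : Env} {x : Var} {M N : Term} {α β θ ρ : Ty}
  (Γ↭ : Γ ↭ Γ₁ ++ Γ₂) (dΓ : Distinct Γ) (bvM#fvN : Disjoint (bv M) (fv N))
  (Δ₁↭ : Δ₁ ↭ (x , α ∧ θ) ∷ Γ₁) (D₁ : Δ₁ ⊢ M ∶ ρ)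
  (Δ₂↭ : Δ₂ ↭ (x , β ∧ θ) ∷ Γ₁) (D₂ : Δ₂ ⊢ M ∶ ρ)
  (D₃ : Γ₂ ⊢ N ∶ (α ∨ β) ∧ θ)
  (ih₁ : SpineInversion Δ₁ M ρ) (ih₂ : SpineInversion Δ₂ M ρ)
  (ih₃ : SpineInversion Γ₂ N ((α ∨ β) ∧ θ))
  where

  Γ₁⊆Γ : Γ₁ ⊆ Γ
  Γ₁⊆Γ = ↭-++-⊆ˡ Γ↭

  Γ₂⊆Γ : Γ₂ ⊆ Γ
  Γ₂⊆Γ = ↭-++-⊆ʳ {Γ₁ = Γ₁} Γ↭

  dΓ₁++Γ₂ : Distinct Γ₁ × Distinct Γ₂ × Disjoint (dom Γ₁) (dom Γ₂)
  dΓ₁++Γ₂ = Distinct-++⁻ Γ₁ (Distinct-resp-↭ Γ↭ dΓ)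

  x∉Γ₁ : x ∉ dom Γ₁
  x∉Γ₁ = head∉dom {A = α ∧ θ} (Distinct-resp-↭ Δ₁↭ (⊢-distinct D₁))

  fresh-arg : ∀ {Δ γ P τ} → Δ ↭ (x , γ) ∷ Γ₁ → x ∉ fv P → Δ ∣ P ⊢ P ∶ τ → Γ ∣ P ⊢ P ∶ τ
  fresh-arg {Δ} {P = P} Δ↭ x∉P = restrict-⊢ dΓ restricted⊆Γ
    where
    restricted⊆Γ : Δ ∣ P ⊆ Γ
    restricted⊆Γ p∈ with ∈-∣⁻ Δ P p∈
    ... | p∈Δ , y∈P with ∈-resp-↭ Δ↭ p∈Δ
    ...   | here refl  = ⊥-elim (x∉P y∈P)
    ...   | there p∈Γ₁ = Γ₁⊆Γ p∈Γ₁

  ∣-[/]-↭ : ∀ {P} → x ∈ fv P → Disjoint (bv P) (fv N) → Γ ∣ (P [ N / x ]) ↭ (Γ₁ ∣ P) ++ Γ₂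
  ∣-[/]-↭ {P} x∈P bvP#fvN = distinct-⊆⊇⇒↭ (Distinct-∣ (P [ N / x ]) dΓ) d-split ⊆-split ⊇-split
    where
    d-split : Distinct ((Γ₁ ∣ P) ++ Γ₂)
    d-split with dΓ₁++Γ₂
    ... | dΓ₁ , dΓ₂ , Γ₁#Γ₂ =
      Distinct-++⁺ (Distinct-∣ P dΓ₁) dΓ₂ (λ (y∈ , y∈Γ₂) → Γ₁#Γ₂ (dom-mono (∣-⊆ Γ₁ P) y∈ , y∈Γ₂))
    ⊆-split : Γ ∣ (P [ N / x ]) ⊆ (Γ₁ ∣ P) ++ Γ₂
    ⊆-split p∈ with ∈-∣⁻ Γ (P [ N / x ]) p∈
    ... | p∈Γ , y∈ with ∈-++⁻ Γ₁ (∈-resp-↭ Γ↭ p∈Γ)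
    ...   | inj₂ p∈Γ₂ = ∈-++⁺ʳ _ p∈Γ₂
    ...   | inj₁ p∈Γ₁ with ∈-fv-[/]⁻ P y∈
    ...     | inj₁ (y∈P , _) = ∈-++⁺ˡ (∈-∣⁺ P p∈Γ₁ y∈P)
    ...     | inj₂ y∈N = ⊥-elim (proj₂ (proj₂ dΓ₁++Γ₂) (∈-dom⁺ p∈Γ₁ , fv⊆dom D₃ y∈N))
    ⊇-split : (Γ₁ ∣ P) ++ Γ₂ ⊆ Γ ∣ (P [ N / x ])
    ⊇-split p∈ with ∈-++⁻ (Γ₁ ∣ P) p∈
    ... | inj₁ p∈Γ₁∣P with ∈-∣⁻ Γ₁ P p∈Γ₁∣P
    ...   | p∈Γ₁ , y∈P =
      ∈-∣⁺ (P [ N / x ]) (Γ₁⊆Γ p∈Γ₁) (∈-fv-[/]⁺ˡ P y∈P λ { refl → x∉Γ₁ (∈-dom⁺ p∈Γ₁) })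
    ⊇-split p∈ | inj₂ p∈Γ₂ =
      ∈-∣⁺ (P [ N / x ]) (Γ₂⊆Γ p∈Γ₂) (∈-fv-[/]⁺ʳ P x∈P bvP#fvN (dom⊆fv D₃ (∈-dom⁺ p∈Γ₂)))

  -- An argument containing x is retyped by the same ∨E, restricted to its free variables.
  substituted-arg : ∀ {P τ} → Disjoint (bv P) (fv N) →
                    Δ₁ ∣ P ⊢ P ∶ τ → Δ₂ ∣ P ⊢ P ∶ τ → Γ ∣ (P [ N / x ]) ⊢ P [ N / x ] ∶ τ
  substituted-arg {P} {τ} bvP#fvN E₁ E₂ with x ∈? fv P
  ... | no x∉P  = subst (λ Q → Γ ∣ Q ⊢ Q ∶ τ) (sym ([/]-fresh P x∉P)) (fresh-arg Δ₁↭ x∉P E₁)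
  ... | yes x∈P = ∨E {M = P} (∣-[/]-↭ {P} x∈P bvP#fvN) (Distinct-∣ (P [ N / x ]) dΓ) bvP#fvN
                     (restricted-↭ Δ₁↭) E₁ (restricted-↭ Δ₂↭) E₂ D₃
    where
    restricted-↭ : ∀ {Δ γ} → Δ ↭ (x , γ) ∷ Γ₁ → Δ ∣ P ↭ (x , γ) ∷ (Γ₁ ∣ P)
    restricted-↭ Δ↭ = ↭-trans (filter-↭ _ Δ↭) (↭-reflexive (filter-accept (λ p → proj₁ p ∈? fv P) x∈P))

  kept-head : ∀ {z Ms A τs σ} → M ≡ spine (var z) Ms → z ≢ x →
              All (λ P → z ∉ fv P) (map[/] N x Ms) → (z , A) ∈ Γ →
              SameLength (map[/] N x Ms) τs → arrowsʳ τs σ ≼ A →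
              σ ≼ ρ × ArgsTyped Γ (map[/] N x Ms) τs
  kept-head {z} {Ms} {A} {τs} {σ} M≡ z≢x z-fresh z∈Γ len σ≼A =
    proj₁ inv₁ , Pointwise-zipWith-∈ (_[ N / x ]) combine (proj₂ inv₁) (proj₂ inv₂)
    where
    z∈Γ₁ : (z , A) ∈ Γ₁
    z∈Γ₁ with dom-resp-↭ Δ₁↭ (fv⊆dom D₁ (head∈fv Ms M≡))
    ... | here z≡x     = ⊥-elim (z≢x z≡x)
    ... | there z∈domΓ₁ = ∈-⊆-dom dΓ Γ₁⊆Γ z∈Γ z∈domΓ₁
    z-fresh′ : All (λ P → z ∉ fv P) Ms
    z-fresh′ = All.map (λ {P} z∉ z∈ → z∉ (∈-fv-[/]⁺ˡ P z∈ z≢x)) (All.map⁻ z-fresh)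
    inv₁ : σ ≼ ρ × ArgsTyped Δ₁ Ms τs
    inv₁ = ih₁ M≡ z-fresh′ (∈-resp-↭ (↭-sym Δ₁↭) (there z∈Γ₁)) (SameLength-map⁻ Ms len) σ≼A
    inv₂ : σ ≼ ρ × ArgsTyped Δ₂ Ms τs
    inv₂ = ih₂ M≡ z-fresh′ (∈-resp-↭ (↭-sym Δ₂↭) (there z∈Γ₁)) (SameLength-map⁻ Ms len) σ≼A
    combine : ∀ {P τ} → P ∈ Ms → Δ₁ ∣ P ⊢ P ∶ τ → Δ₂ ∣ P ⊢ P ∶ τ → Γ ∣ (P [ N / x ]) ⊢ P [ N / x ] ∶ τ
    combine {P} P∈ = substituted-arg {P} λ (u , v) → bvM#fvN (arg-bv⊆bv Ms M≡ P∈ u , v)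

  Γ₁-empty : M ≡ var x → Γ₁ ≡ []
  Γ₁-empty M≡x = Subset.⊆[]⇒≡[] Γ₁⊆[]
    where
    Γ₁⊆[] : Γ₁ ⊆ []
    Γ₁⊆[] p∈ with subst (λ T → _ ∈ fv T) M≡x (dom⊆fv D₁ (dom-resp-↭ (↭-sym Δ₁↭) (there (∈-dom⁺ p∈))))
    ... | here y≡x = ⊥-elim (x∉Γ₁ (subst (_∈ dom Γ₁) y≡x (∈-dom⁺ p∈)))

  -- For M = x the rule instance is a cut of σ against the two branches.
  ≼-via-var : ∀ {σ} → M ≡ var x → σ ≼ (α ∨ β) ∧ θ → σ ≼ ρ
  ≼-via-var {σ} M≡x σ≼ y =
    subst (λ T → [ (y , σ) ] ⊢ T ∶ ρ) (var-[/]-self x (var y))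
      (∨E {Γ₁ = []} ↭-refl ([] ∷ []) (λ { (() , _) })
          (subst (λ E → Δ₁ ↭ (x , α ∧ θ) ∷ E) Γ₁≡[] Δ₁↭) (subst (λ T → Δ₁ ⊢ T ∶ ρ) M≡x D₁)
          (subst (λ E → Δ₂ ↭ (x , β ∧ θ) ∷ E) Γ₁≡[] Δ₂↭) (subst (λ T → Δ₂ ⊢ T ∶ ρ) M≡x D₂)
          (σ≼ y))
    where
    Γ₁≡[] : Γ₁ ≡ []
    Γ₁≡[] = Γ₁-empty M≡x

  via-branch : ∀ {Δ γ Ms τs σ} → Δ ↭ (x , γ) ∷ Γ₁ → SpineInversion Δ M ρ → M ≡ spine (var x) Ms →
               All (λ P → x ∉ fv P) Ms → SameLength Ms τs → arrowsʳ τs σ ≼ γ →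
               σ ≼ ρ × ArgsTyped Γ Ms τs
  via-branch Δ↭ ih M≡ x-fresh len σ≼γ =
    map₂ (Pointwise-map-∈ (λ P∈ → fresh-arg Δ↭ (All.lookup x-fresh P∈)))
         (ih M≡ x-fresh (∈-resp-↭ (↭-sym Δ↭) (here refl)) len σ≼γ)

  replacing-args : ∀ {z Ns A τs σ} → N ≡ spine (var z) Ns → All (λ P → z ∉ fv P) Ns → (z , A) ∈ Γ →
                   SameLength Ns τs → arrowsʳ τs σ ≼ A → σ ≼ (α ∨ β) ∧ θ × ArgsTyped Γ Ns τs
  replacing-args {z} {Ns} {A} N≡ z-fresh z∈Γ len σ≼A =
    map₂ (ArgsTyped-⊆ dΓ Γ₂⊆Γ) (ih₃ N≡ z-fresh z∈Γ₂ len σ≼A)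
    where
    z∈Γ₂ : (z , A) ∈ Γ₂
    z∈Γ₂ = ∈-⊆-dom dΓ Γ₂⊆Γ z∈Γ (fv⊆dom D₃ (head∈fv Ns N≡))

  -- For nonempty Ms the type derived for x is an arrow, hence prime, so one branch alone types x Ms.
  replaced-head-split : ∀ {z Ms Ns A τs₁ τs₂ σ} → M ≡ spine (var x) Ms → N ≡ spine (var z) Ns →
                        All (λ P → x ∉ fv P) Ms → All (λ P → z ∉ fv P) Ns → (z , A) ∈ Γ →
                        SameLength Ms τs₁ → SameLength Ns τs₂ → arrowsʳ τs₂ (arrowsʳ τs₁ σ) ≼ A →
                        σ ≼ ρ × ArgsTyped Γ (Ms ++ Ns) (τs₁ ++ τs₂)
  replaced-head-split M≡ N≡ x-fresh z-fresh z∈Γ [] len₂ σ≼A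
    with replacing-args N≡ z-fresh z∈Γ len₂ σ≼A
  ... | σ≼∨ , argsN = ≼-via-var M≡ σ≼∨ , argsN
  replaced-head-split {τs₁ = τ ∷ τs₁} {σ = σ} M≡ N≡ x-fresh z-fresh z∈Γ len₁@(_ ∷ _) len₂ σ≼A
    with replacing-args N≡ z-fresh z∈Γ len₂ σ≼A | arrowsʳ-∷ τ τs₁ σ
  ... | σ≼∨ , argsN | _ , _ , ≡⇒ with ⇒≼-prime (subst (_≼ (α ∨ β) ∧ θ) ≡⇒ σ≼∨)
  ...   | inj₁ ≼α = map₂ (λ args → Pointwise.++⁺ args argsN)
                         (via-branch Δ₁↭ ih₁ M≡ x-fresh len₁ (subst (_≼ α ∧ θ) (sym ≡⇒) ≼α))
  ...   | inj₂ ≼β = map₂ (λ args → Pointwise.++⁺ args argsN)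
                         (via-branch Δ₂↭ ih₂ M≡ x-fresh len₁ (subst (_≼ β ∧ θ) (sym ≡⇒) ≼β))

  replaced-head : ∀ {z Ms Ns A τs σ} → M ≡ spine (var x) Ms → N ≡ spine (var z) Ns →
                  All (λ P → z ∉ fv P) (map[/] N x Ms ++ Ns) → (z , A) ∈ Γ →
                  SameLength (map[/] N x Ms ++ Ns) τs → arrowsʳ τs σ ≼ A →
                  σ ≼ ρ × ArgsTyped Γ (map[/] N x Ms ++ Ns) τs
  replaced-head {z} {Ms} {Ns} {A} {τs} {σ} M≡ N≡ z-fresh z∈Γ len σ≼A =
    subst (λ Ms′ → σ ≼ ρ × ArgsTyped Γ (Ms′ ++ Ns) τs) (sym Ms-unchanged)
          (split (subst (λ Ms′ → SameLength (Ms′ ++ Ns) τs) Ms-unchanged len) σ≼A)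
    where
    -- x ∈ fv P would put z ∈ fv N into fv (P [ N / x ]).
    x-fresh : All (λ P → x ∉ fv P) Ms
    x-fresh = All.tabulate λ {P} P∈ x∈P →
      All.lookup (All.map⁻ (All.++⁻ˡ _ z-fresh)) P∈
        (∈-fv-[/]⁺ʳ P x∈P (λ (u , v) → bvM#fvN (arg-bv⊆bv Ms M≡ P∈ u , v))
                    (head∈fv Ns N≡))
    Ms-unchanged : map[/] N x Ms ≡ Ms
    Ms-unchanged = map-id-local (All.map (λ {P} → [/]-fresh P) x-fresh)
    split : ∀ {τs} → SameLength (Ms ++ Ns) τs → arrowsʳ τs σ ≼ A → σ ≼ ρ × ArgsTyped Γ (Ms ++ Ns) τs
    split len′ σ≼A′ with SameLength-++⁻ Ms len′
    ... | τs₁ , τs₂ , refl , len₁ , len₂ =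
      replaced-head-split M≡ N≡ x-fresh (All.++⁻ʳ _ z-fresh) z∈Γ len₁ len₂
                          (subst (_≼ A) (arrowsʳ-++ τs₁ τs₂ σ) σ≼A′)

  spine-inversion-∨E : SpineInversion Γ (M [ N / x ]) ρ
  spine-inversion-∨E {z} {Ms} eq with spine[/]-view M N x z Ms eq
  ... | head-kept Ms′ M≡ z≢x refl       = kept-head M≡ z≢x
  ... | head-replaced Ms′ Ns M≡ N≡ refl = replaced-head M≡ N≡

spine-inversion : ∀ {Δ T ρ} → Δ ⊢ T ∶ ρ → SpineInversion Δ T ρ
spine-inversion Ax eq _ (here refl) len σ≼A with spine-cancel [] _ var eq
... | refl , refl with len
...   | [] = σ≼A , []
spine-inversion (→I _ _) {Ms = Ms} eq with proj₁ (spine-cancel [] Ms lam eq)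
... | ()
spine-inversion (→E {Γ₁ = Γ₁} Γ↭ dΓ D₁ D₂) eq z-fresh z∈Γ len σ≼A with spine-app-inv eq
... | Ms , refl , M≡ with z-fresh | len
...   | _ ∷ z-fresh′ | _ ∷ len′
        with spine-inversion D₁ M≡ z-fresh′ (∈-⊆-dom dΓ (↭-++-⊆ˡ Γ↭) z∈Γ (fv⊆dom D₁ (head∈fv Ms M≡)))
                             len′ σ≼A
...     | ⇒≼⇒ , args with ⇒≼⇒-injective ⇒≼⇒
...       | refl , refl =
  ≼-refl , restrict-⊢ dΓ (↭-++-⊆ʳ {Γ₁ = Γ₁} Γ↭) D₂ ∷ ArgsTyped-⊆ {Γ₁} dΓ (↭-++-⊆ˡ Γ↭) args
spine-inversion (∧I D₁ D₂) eq z-fresh z∈ len σ≼A with spine-inversion D₁ eq z-fresh z∈ len σ≼A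
... | s₁ , args = (λ y → ∧I (s₁ y) (proj₁ (spine-inversion D₂ eq z-fresh z∈ len σ≼A) y)) , args
spine-inversion (∧E₁ D) eq z-fresh z∈ len σ≼A =
  map₁ (λ s y → ∧E₁ (s y)) (spine-inversion D eq z-fresh z∈ len σ≼A)
spine-inversion (∧E₂ D) eq z-fresh z∈ len σ≼A =
  map₁ (λ s y → ∧E₂ (s y)) (spine-inversion D eq z-fresh z∈ len σ≼A)
spine-inversion (∨I₁ D) eq z-fresh z∈ len σ≼A =
  map₁ (λ s y → ∨I₁ (s y)) (spine-inversion D eq z-fresh z∈ len σ≼A)
spine-inversion (∨I₂ D) eq z-fresh z∈ len σ≼A =
  map₁ (λ s y → ∨I₂ (s y)) (spine-inversion D eq z-fresh z∈ len σ≼A)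
spine-inversion (∨E Γ↭ dΓ bv#fv Δ₁↭ D₁ Δ₂↭ D₂ D₃) =
  ∨E-Inversion.spine-inversion-∨E Γ↭ dΓ bv#fv Δ₁↭ D₁ Δ₂↭ D₂ D₃
    (spine-inversion D₁) (spine-inversion D₂) (spine-inversion D₃)

spine-head-fresh : ∀ {x} Ms → Linear (spine (var x) Ms) → All (λ P → x ∉ fv P) Ms
spine-head-fresh []       _                      = []
spine-head-fresh (N ∷ Ms) (lin-app lin _ fvS#fvN) =
  (λ x∈N → fvS#fvN (head∈fv Ms refl , x∈N)) ∷ spine-head-fresh Ms lin

spine-typing : ∀ {Δ x σ} Ms {τs} → Distinct Δ → Linear (spine (var x) Ms) → (x , arrowsʳ τs σ) ∈ Δ →
               ArgsTyped Δ Ms τs → Δ ∣ spine (var x) Ms ⊢ spine (var x) Ms ∶ σ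
spine-typing [] dΔ _ x∈Δ [] = restrict-⊢ dΔ (λ { (here refl) → x∈Δ }) Ax
spine-typing {Δ} {x} (N ∷ Ms) dΔ (lin-app lin _ fvS#fvN) x∈Δ (E ∷ Es) =
  restrict-⊢ dΔ parts⊆Δ
    (→E ↭-refl (Distinct-++⁺ (Distinct-∣ S dΔ) (Distinct-∣ N dΔ) disjoint)
        (spine-typing Ms dΔ lin x∈Δ Es) E)
  where
  S : Term
  S = spine (var x) Ms
  disjoint : Disjoint (dom (Δ ∣ S)) (dom (Δ ∣ N))
  disjoint (y∈S , y∈N) = fvS#fvN (dom-∣⊆fv Δ S y∈S , dom-∣⊆fv Δ N y∈N)
  parts⊆Δ : (Δ ∣ S) ++ (Δ ∣ N) ⊆ Δ
  parts⊆Δ p∈ with ∈-++⁻ (Δ ∣ S) p∈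
  ... | inj₁ p∈S = ∣-⊆ Δ S p∈S
  ... | inj₂ p∈N = ∣-⊆ Δ N p∈N

apps-spine : ∀ {n} h Ns (Ms : Vec Term n) → apps (spine h Ns) Ms ≡ spine h (reverseAcc Ns (toList Ms))
apps-spine h Ns []       = refl
apps-spine h Ns (M ∷ Ms) = apps-spine h (M ∷ Ns) Ms

arrowsʳ-reverseAcc : ∀ {n} τs (τs′ : Vec Ty n) σ →
                     arrowsʳ (reverseAcc τs (toList τs′)) σ ≡ arrowsʳ τs (arrows τs′ σ)
arrowsʳ-reverseAcc τs []        σ = refl
arrowsʳ-reverseAcc τs (τ ∷ τs′) σ = arrowsʳ-reverseAcc (τ ∷ τs) τs′ σ

SameLength-toList : ∀ {n} (Ms : Vec Term n) (τs : Vec Ty n) → SameLength (toList Ms) (toList τs)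
SameLength-toList []       []       = []
SameLength-toList (M ∷ Ms) (τ ∷ τs) = tt ∷ SameLength-toList Ms τs

Pointwise-lookup : ∀ {A B : Set} {R : A → B → Set} {n} (xs : Vec A n) (ys : Vec B n) →
                   Pointwise R (toList xs) (toList ys) → ∀ i → R (lookup xs i) (lookup ys i)
Pointwise-lookup (x ∷ xs) (y ∷ ys) (r ∷ rs) zero    = r
Pointwise-lookup (x ∷ xs) (y ∷ ys) (r ∷ rs) (suc i) = Pointwise-lookup xs ys rs i

Pointwise-lookup-reverse : ∀ {A B : Set} {R : A → B → Set} {n} (xs : Vec A n) (ys : Vec B n) →
                           Pointwise R (reverse (toList xs)) (reverse (toList ys)) →
                           ∀ i → R (lookup xs i) (lookup ys i)
Pointwise-lookup-reverse xs ys rs =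
  Pointwise-lookup xs ys
    (subst₂ (Pointwise _) (reverse-involutive _) (reverse-involutive _) (Pointwise.reverse⁺ rs))

mainTheorem13 : (n : ℕ) (Γ : Env) (x : Var) (τs : Vec Ty n) (σ ρ : Ty) (Ms : Vec Term n) →
    Linear (apps (var x) Ms) →
    ((x , arrows τs σ) ∷ Γ) ⊢ apps (var x) Ms ∶ ρ →
    (((x , arrows τs σ) ∷ Γ) ⊢ apps (var x) Ms ∶ σ
      × ((i : Fin n) → (Γ ∣ lookup Ms i) ⊢ lookup Ms i ∶ lookup τs i))
    × ((y : Var) → [ (y , σ) ] ⊢ var y ∶ ρ)
mainTheorem13 n Γ x τs σ ρ Ms lin D =
  (typed-at-σ , Pointwise-lookup-reverse Ms τs args-typed) , proj₁ inversion
  where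
  Δ : Env
  Δ = (x , arrows τs σ) ∷ Γ
  Ms↑ : List Term
  Ms↑ = reverse (toList Ms)
  apps≡ : apps (var x) Ms ≡ spine (var x) Ms↑
  apps≡ = apps-spine (var x) [] Ms
  x∈Δ : (x , arrowsʳ (reverse (toList τs)) σ) ∈ Δ
  x∈Δ = here (cong (x ,_) (arrowsʳ-reverseAcc [] τs σ))
  linear : Linear (spine (var x) Ms↑)
  linear = subst Linear apps≡ lin
  x-fresh : All (λ P → x ∉ fv P) Ms↑
  x-fresh = spine-head-fresh Ms↑ linear
  inversion : σ ≼ ρ × ArgsTyped Δ Ms↑ (reverse (toList τs))
  inversion = spine-inversion D apps≡ x-fresh x∈Δ (Pointwise.reverse⁺ (SameLength-toList Ms τs)) ≼-refl
  typed-at-σ : Δ ⊢ apps (var x) Ms ∶ σ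
  typed-at-σ =
    subst₂ (λ E T → E ⊢ T ∶ σ) (∣-all (spine (var x) Ms↑) (subst (λ T → dom Δ ⊆ fv T) apps≡ (dom⊆fv D)))
           (sym apps≡) (spine-typing Ms↑ (⊢-distinct D) linear x∈Δ (proj₂ inversion))
  args-typed : ArgsTyped Γ Ms↑ (reverse (toList τs))
  args-typed = Pointwise-map-∈ (λ {P} P∈ → subst (λ E → E ⊢ P ∶ _) (∣-∷-fresh P (All.lookup x-fresh P∈)))
                              (proj₂ inversion)
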